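{- Let $T$ be a decomposition tree and $v$ an internal node of $T$ labeled $\oplus$, with left child $v_l$ and right child $v_r$, such that both $v_l$ and $v_r$ have the staircase property. Suppose that $\hat\alpha(v_r)\le\hat\beta(v_l)$, and that neither ($\hat\alpha(v_l)=\hat\beta(v_r)=0$) nor ($\hat\alpha(v_r)=\hat\beta(v_l)=0$) holds. Then $\hat\beta(v)=\hat\beta(v_l)-\hat\alpha(v_r)$.
   Context: All graphs are finite, simple and undirected. For a graph $H$ and $S\subseteq V(H)$, $N_H[S]$ is the closed neighbourhood of $S$ in $H$ and $H[S]$ the induced subgraph; a graph with no vertices is regarded as having a (empty) perfect matching. A decomposition tree is a rooted tree $T$ in which every internal node has exactly two children, a left child $v_l$ and a right child $v_r$, and carries one of the labels $\otimes$ (true twin), $\odot$ (false twin), $\oplus$ (attachment). To each node $v$ are associated a graph $\hat G(v)$ and a twin set $\hat{TS}(v)\subseteq V(\hat G(v))$: for a leaf, $\hat G(v)$ is a single vertex $x$ (distinct leaves giving distinct vertices) and $\hat{TS}(v)=\{x\}$; for an internal node $v$, $V(\hat G(v))=V(\hat G(v_l))\cup V(\hat G(v_r))$ and: if $v$ is labeled $\otimes$, $E(\hat G(v))=E(\hat G(v_l))\cup E(\hat G(v_r))\cup\{xy: x\in \hat{TS}(v_l), y\in\hat{TS}(v_r)\}$ and $\hat{TS}(v)=\hat{TS}(v_l)\cup\hat{TS}(v_r)$; if labeled $\odot$, $E(\hat G(v))=E(\hat G(v_l))\cup E(\hat G(v_r))$ and $\hat{TS}(v)=\hat{TS}(v_l)\cup\hat{TS}(v_r)$;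 if labeled $\oplus$, the edge set is as for $\otimes$ and $\hat{TS}(v)=\hat{TS}(v_l)$. For a node $u$ and $0\le k\le|\hat{TS}(u)|$, $\hat\gamma_k(u)$ is the minimum of $|S|$ over all $S\subseteq V(\hat G(u))$ with $V(\hat G(u))\setminus \hat{TS}(u)\subseteq N_{\hat G(u)}[S]$ for which there is $X\subseteq S\cap\hat{TS}(u)$, $|X|=k$, such that $\hat G(u)[S\setminus X]$ has a perfect matching. Let $\widehat{\min}(u)=\min\{\hat\gamma_k(u):0\le k\le|\hat{TS}(u)|\}$, and let $\hat\alpha(u)$ (resp. $\hat\beta(u)$) be the smallest (resp. largest) $k$ with $\hat\gamma_k(u)=\widehat{\min}(u)$. A node $u$ has the staircase property if for every $0\le k\le|\hat{TS}(u)|$: $\hat\gamma_k(u)=\widehat{\min}(u)+\hat\alpha(u)-k$ if $k\le\hat\alpha(u)$; $\hat\gamma_k(u)=\widehat{\min}(u)+k-\hat\beta(u)$ if $k\ge\hat\beta(u)$; $\hat\gamma_k(u)=\widehat{\min}(u)$ if $\hat\alpha(u)<k<\hat\beta(u)$ and $k-\hat\alpha(u)$ is even; and $\hat\gamma_k(u)=\widehat{\min}(u)+1$ otherwise. -}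

module Defs where

open import Data.Nat using (ℕ; zero; suc; _+_; _∸_; _≤_; _<_)
open import Data.Bool using (Bool; true; false; _∧_; not; if_then_else_)
open import Data.Unit using (⊤; tt)
open import Data.Sum using (_⊎_; inj₁; inj₂)
open import Data.Product using (Σ; Σ-syntax; ∃-syntax; _×_; _,_)
open import Data.List using (List; []; _∷_; _++_; map)
open import Data.Nat.ListAction using (sum)
open import Relation.Binary.PropositionalEquality using (_≡_)
open import Relation.Nullary using (¬_)

-- Node labels: ⊗ (true twin), ⊙ (false twin), ⊕ (attachment)
data Label : Set where
  trueTwin falseTwin attach : Label

data Tree : Set where
  leaf : Tree
  node : Label → Tree → Tree → Tree

-- Vertices of Ĝ(t): one per leaf (distinct leaves give distinct vertices)
Vert : Tree → Set
Vert leaf = ⊤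
Vert (node _ l r) = Vert l ⊎ Vert r

TS : (t : Tree) → Vert t → Bool
TS leaf _ = true
TS (node attach l r) (inj₁ x) = TS l x
TS (node attach l r) (inj₂ y) = false
TS (node trueTwin l r) (inj₁ x) = TS l x
TS (node trueTwin l r) (inj₂ y) = TS r y
TS (node falseTwin l r) (inj₁ x) = TS l x
TS (node falseTwin l r) (inj₂ y) = TS r y

-- whether the label adds all edges between T̂S(v_l) and T̂S(v_r)
cross : Label → Bool
cross trueTwin = true
cross falseTwin = false
cross attach = true

Adj : (t : Tree) → Vert t → Vert t → Bool
Adj leaf _ _ = false
Adj (node lab l r) (inj₁ x) (inj₁ y) = Adj l x y
Adj (node lab l r) (inj₂ x) (inj₂ y) = Adj r x y
Adj (node lab l r) (inj₁ x) (inj₂ y) = cross lab ∧ (TS l x ∧ TS r y)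
Adj (node lab l r) (inj₂ y) (inj₁ x) = cross lab ∧ (TS l x ∧ TS r y)

verts : (t : Tree) → List (Vert t)
verts leaf = tt ∷ []
verts (node _ l r) = map inj₁ (verts l) ++ map inj₂ (verts r)

Subset : Tree → Set
Subset t = Vert t → Bool

card : (t : Tree) → Subset t → ℕ
card t S = sum (map (λ x → if S x then 1 else 0) (verts t))

DominatesNonTwins : (t : Tree) → Subset t → Set
DominatesNonTwins t S =
  ∀ x → TS t x ≡ false → ∃[ y ] (S y ≡ true × (y ≡ x ⊎ Adj t y x ≡ true))

-- Ĝ(t)[W] has a perfect matching (given by a mate function: a fixed-point-free
-- involution on W pairing each vertex with an adjacent vertex of W)
HasPerfectMatching : (t : Tree) → Subset t → Set
HasPerfectMatching t W =
  Σ[ m ∈ (Vert t → Vert t) ]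
    (∀ x → W x ≡ true → (W (m x) ≡ true × Adj t x (m x) ≡ true × m (m x) ≡ x))

Feasible : (t : Tree) → ℕ → ℕ → Set
Feasible t k s =
  Σ[ S ∈ Subset t ] (card t S ≡ s × DominatesNonTwins t S ×
    Σ[ X ∈ Subset t ] ((∀ x → X x ≡ true → (S x ≡ true × TS t x ≡ true)) ×
       card t X ≡ k ×
       HasPerfectMatching t (λ x → S x ∧ not (X x))))

IsGamma : (t : Tree) → ℕ → ℕ → Set
IsGamma t k g = Feasible t k g × (∀ s → Feasible t k s → g ≤ s)

tsSize : Tree → ℕ
tsSize t = card t (TS t)

IsMin : Tree → ℕ → Set
IsMin t m =
  (∃[ k ] (k ≤ tsSize t × IsGamma t k m)) ×
  (∀ k → k ≤ tsSize t → ∀ s → Feasible t k s → m ≤ s)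

IsAlpha : Tree → ℕ → Set
IsAlpha t a = Σ[ m ∈ ℕ ] (IsMin t m × a ≤ tsSize t × IsGamma t a m ×
  (∀ k → k ≤ tsSize t → IsGamma t k m → a ≤ k))

IsBeta : Tree → ℕ → Set
IsBeta t b = Σ[ m ∈ ℕ ] (IsMin t m × b ≤ tsSize t × IsGamma t b m ×
  (∀ k → k ≤ tsSize t → IsGamma t k m → k ≤ b))

Even : ℕ → Set
Even n = ∃[ j ] (n ≡ j + j)

StairVal : ℕ → ℕ → ℕ → ℕ → ℕ → Set
StairVal m a b k g =
  (k ≤ a → g ≡ m + (a ∸ k)) ×
  (b ≤ k → g ≡ m + (k ∸ b)) ×
  (a < k → k < b → Even (k ∸ a) → g ≡ m) ×
  (a < k → k < b → ¬ Even (k ∸ a) → g ≡ suc m)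

Staircase : Tree → Set
Staircase t = Σ[ m ∈ ℕ ] Σ[ a ∈ ℕ ] Σ[ b ∈ ℕ ]
  (IsMin t m × IsAlpha t a × IsBeta t b ×
   (∀ k → k ≤ tsSize t → Σ[ g ∈ ℕ ] (IsGamma t k g × StairVal m a b k g)))

{-# OPTIONS --safe #-}
module Submission where

-- At an attachment node v, Ĝ(v) is Ĝ(v_l) and Ĝ(v_r) joined by all edges between T̂S(v_l) and
-- T̂S(v_r), and T̂S(v) = T̂S(v_l).  In a witness for γ̂_k(v) the matching edges across this join
-- pair j twins of v_l with j twins of v_r; moving their ends into the excluded sets splits the
-- witness into witnesses for γ̂_{k+j}(v_l) and γ̂_j(v_r) of the same total size.  Conversely such
-- witnesses glue to one for γ̂_k(v) by matching the j excluded twins of v_r with j excluded twins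
-- of v_l; when k + j > 0 the excluded twins of v_l also dominate T̂S(v_r), which is no longer
-- part of T̂S(v).  Hence min̂(v) = min̂(v_l) + min̂(v_r), and γ̂_k(v) attains it only if
-- γ̂_{k+j}(v_l) and γ̂_j(v_r) are both minimal for some j, forcing k + j ≤ β̂(v_l) and α̂(v_r) ≤ j;
-- j = α̂(v_r) and k + j = β̂(v_l) show that k = β̂(v_l) − α̂(v_r) is attained.

open import Defs
open import Data.Nat using (ℕ; zero; suc; _+_; _∸_; _≤_; _<_; z≤n; z<s)
open import Data.Nat.Properties
  using (+-identityʳ; +-suc; +-mono-≤; +-monoʳ-≤; +-cancelˡ-≡; +-cancelʳ-≤; ≤-antisym; ≤-refl;
         ≤-trans; n≢0⇒n>0; n≤0⇒n≡0; suc-injective; m∸n+n≡m; m+n≤o⇒m≤o∸n;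
         +-commutativeSemigroup; module ≤-Reasoning)
open import Algebra.Properties.CommutativeSemigroup +-commutativeSemigroup using (interchange)
open import Data.Nat.ListAction using (sum)
open import Data.Nat.ListAction.Properties using (sum-++)
open import Data.Bool using (Bool; true; false; _∧_; _∨_; not; if_then_else_)
open import Data.Bool.Properties using (∧-identityʳ; ∧-zeroʳ; ∨-identityʳ; ∨-zeroʳ)
open import Data.Unit using (tt)
import Data.Unit.Properties as ⊤
open import Data.Sum using (_⊎_; inj₁; inj₂; [_,_]; map₁)
import Data.Sum as ⊎
open import Data.Sum.Properties using (≡-dec; inj₁-injective; inj₂-injective)
open import Data.Product using (∃-syntax; _×_; _,_; proj₁; proj₂)
open import Data.List using (map)
open import Data.List.Properties using (map-++; map-cong; map-∘)
open import Function using (_∘_; const; id)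
open import Relation.Binary.Definitions using (DecidableEquality)
open import Relation.Binary.PropositionalEquality hiding ([_])
open import Relation.Nullary using (¬_; does; yes; no; contradiction)
open import Relation.Nullary.Decidable using (dec-true; dec-false)

∧-true⁻ : ∀ {a b} → a ∧ b ≡ true → a ≡ true × b ≡ true
∧-true⁻ {true} b≡true = refl , b≡true

∨-true⁻ : ∀ {a b} → a ∨ b ≡ true → a ≡ true ⊎ b ≡ true
∨-true⁻ {true}  _      = inj₁ refl
∨-true⁻ {false} b≡true = inj₂ b≡true

not-true⁻ : ∀ {a} → not a ≡ true → a ≡ false
not-true⁻ {false} _ = refl

infixl 6 _∖_
infixl 5 _∪_
infix 4 _⊆_

_∪_ _∖_ : {A : Set} → (A → Bool) → (A → Bool) → A → Bool
(P ∪ Q) x = P x ∨ Q x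
(P ∖ Q) x = P x ∧ not (Q x)

∅ : {A : Set} → A → Bool
∅ _ = false

_⊆_ : {A : Set} → (A → Bool) → (A → Bool) → Set
P ⊆ Q = ∀ x → P x ≡ true → Q x ≡ true

∖-⊆ : {A : Set} (P Q : A → Bool) → P ∖ Q ⊆ P
∖-⊆ _ _ _ = proj₁ ∘ ∧-true⁻

LeftInverseOn : {A B : Set} → (A → Bool) → (B → Bool) → (A → B) → (B → A) → Set
LeftInverseOn P Q f g = ∀ x → P x ≡ true → Q (f x) ≡ true × g (f x) ≡ x

⊆∩TS : (t : Tree) → Subset t → Subset t → Set
⊆∩TS t S X = ∀ x → X x ≡ true → S x ≡ true × TS t x ≡ true

syntax ⊆∩TS t S X = X ⊆ S ∩TS t

isLeft : {A B : Set} → A ⊎ B → Bool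
isLeft = [ const true , const false ]

Vert-≟ : (t : Tree) → DecidableEquality (Vert t)
Vert-≟ leaf         = ⊤._≟_
Vert-≟ (node _ l r) = ≡-dec (Vert-≟ l) (Vert-≟ r)

singleton : (t : Tree) → Vert t → Subset t
singleton t x y = does (Vert-≟ t y x)

∖-singleton⁺ : (t : Tree) {P : Subset t} {x y : Vert t} →
  P y ≡ true → y ≢ x → (P ∖ singleton t x) y ≡ true
∖-singleton⁺ t {x = x} {y} Py y≢x rewrite Py | dec-false (Vert-≟ t y x) y≢x = refl

∖-singleton⁻ : (t : Tree) {P : Subset t} {x y : Vert t} →
  (P ∖ singleton t x) y ≡ true → P y ≡ true × y ≢ x
∖-singleton⁻ t {P} {x} {y} y∈ with Py , y∉singleton ← ∧-true⁻ {P y} y∈ =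
  Py , λ y≡x → contradiction (trans (sym (not-true⁻ y∉singleton)) (dec-true (Vert-≟ t y x) y≡x)) λ ()

Adj-sym : (t : Tree) (x y : Vert t) → Adj t x y ≡ Adj t y x
Adj-sym leaf         _        _        = refl
Adj-sym (node _ l r) (inj₁ x) (inj₁ y) = Adj-sym l x y
Adj-sym (node _ l r) (inj₂ x) (inj₂ y) = Adj-sym r x y
Adj-sym (node _ l r) (inj₁ x) (inj₂ y) = refl
Adj-sym (node _ l r) (inj₂ x) (inj₁ y) = refl

Adj-cross⁻ : (lab : Label) {l r : Tree} {a : Vert l} {b : Vert r} →
  Adj (node lab l r) (inj₁ a) (inj₂ b) ≡ true → TS l a ≡ true × TS r b ≡ true
Adj-cross⁻ lab adj = ∧-true⁻ (proj₂ (∧-true⁻ {cross lab} adj))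

card-node : (lab : Label) (l r : Tree) (P : Subset (node lab l r)) →
  card (node lab l r) P ≡ card l (P ∘ inj₁) + card r (P ∘ inj₂)
card-node lab l r P =
  trans (cong sum (map-++ indicator (map inj₁ (verts l)) (map inj₂ (verts r))))
    (trans (sum-++ (map indicator (map inj₁ (verts l))) (map indicator (map inj₂ (verts r))))
      (cong₂ _+_ (cong sum (sym (map-∘ (verts l)))) (cong sum (sym (map-∘ (verts r))))))
  where
  indicator : Vert (node lab l r) → ℕ
  indicator x = if P x then 1 else 0

card-cong : (t : Tree) {P Q : Subset t} → P ≗ Q → card t P ≡ card t Q
card-cong t P≗Q = cong sum (map-cong (λ x → cong (if_then 1 else 0) (P≗Q x)) (verts t))

card-∅ : (t : Tree) → card t ∅ ≡ 0
card-∅ leaf           = refl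
card-∅ (node lab l r) = trans (card-node lab l r ∅) (cong₂ _+_ (card-∅ l) (card-∅ r))

card-left : (lab : Label) (l r : Tree) (P : Subset (node lab l r)) →
  P ∘ inj₂ ≗ ∅ → card (node lab l r) P ≡ card l (P ∘ inj₁)
card-left lab l r P right≗∅ =
  trans (card-node lab l r P)
    (trans (cong (card l (P ∘ inj₁) +_) (trans (card-cong r right≗∅) (card-∅ r))) (+-identityʳ _))

card-right : (lab : Label) (l r : Tree) (P : Subset (node lab l r)) →
  P ∘ inj₁ ≗ ∅ → card (node lab l r) P ≡ card r (P ∘ inj₂)
card-right lab l r P left≗∅ =
  trans (card-node lab l r P) (cong (_+ card r (P ∘ inj₂)) (trans (card-cong l left≗∅) (card-∅ l)))

card-∪ : (t : Tree) (P Q : Subset t) → (∀ x → P x ∧ Q x ≡ false) →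
  card t (P ∪ Q) ≡ card t P + card t Q
card-∪ leaf P Q disjoint with P tt | Q tt | disjoint tt
... | true  | true  | ()
... | true  | false | _ = refl
... | false | _     | _ = refl
card-∪ (node lab l r) P Q disjoint = begin
  card (node lab l r) (P ∪ Q)
    ≡⟨ card-node lab l r (P ∪ Q) ⟩
  card l (P ∘ inj₁ ∪ Q ∘ inj₁) + card r (P ∘ inj₂ ∪ Q ∘ inj₂)
    ≡⟨ cong₂ _+_ (card-∪ l _ _ (disjoint ∘ inj₁)) (card-∪ r _ _ (disjoint ∘ inj₂)) ⟩
  (card l (P ∘ inj₁) + card l (Q ∘ inj₁)) + (card r (P ∘ inj₂) + card r (Q ∘ inj₂))
    ≡⟨ interchange (card l (P ∘ inj₁)) _ _ _ ⟩
  (card l (P ∘ inj₁) + card r (P ∘ inj₂)) + (card l (Q ∘ inj₁) + card r (Q ∘ inj₂))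
    ≡⟨ cong₂ _+_ (card-node lab l r P) (card-node lab l r Q) ⟨
  card (node lab l r) P + card (node lab l r) Q
    ∎
  where open ≡-Reasoning

card-singleton : (t : Tree) (x : Vert t) → card t (singleton t x) ≡ 1
card-singleton leaf           tt       = refl
card-singleton (node lab l r) (inj₁ a) = trans (card-left lab l r _ (λ _ → refl)) (card-singleton l a)
card-singleton (node lab l r) (inj₂ b) = trans (card-right lab l r _ (λ _ → refl)) (card-singleton r b)

card-remove : (t : Tree) (P : Subset t) {x : Vert t} → P x ≡ true →
  card t P ≡ suc (card t (P ∖ singleton t x))
card-remove t P {x} Px = begin
  card t P                                   ≡⟨ card-cong t split ⟩
  card t (singleton t x ∪ P ∖ singleton t x) ≡⟨ card-∪ t _ _ disjoint ⟩
  card t (singleton t x) + card t P′         ≡⟨ cong (_+ card t P′) (card-singleton t x) ⟩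
  suc (card t P′)                            ∎
  where
  open ≡-Reasoning
  P′ : Subset t
  P′ = P ∖ singleton t x
  split : P ≗ singleton t x ∪ P ∖ singleton t x
  split y with Vert-≟ t y x
  ... | yes refl = Px
  ... | no _     = sym (∧-identityʳ (P y))
  disjoint : ∀ y → singleton t x y ∧ (P ∖ singleton t x) y ≡ false
  disjoint y with Vert-≟ t y x
  ... | yes _ = ∧-zeroʳ (P y)
  ... | no _  = refl

card≡0⇒∅ : (t : Tree) (P : Subset t) → card t P ≡ 0 → P ≗ ∅
card≡0⇒∅ t P card≡0 x with P x in Px
... | false = refl
... | true with () ← trans (sym card≡0) (card-remove t P Px)

card>0⇒∃ : (t : Tree) (P : Subset t) → 0 < card t P → ∃[ x ] P x ≡ true
card>0⇒∃ leaf P pos with P tt in Ptt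
card>0⇒∃ leaf P pos | true  = tt , Ptt
card>0⇒∃ leaf P ()  | false
card>0⇒∃ (node lab l r) P pos = split (subst (0 <_) (card-node lab l r P) pos)
  where
  split : 0 < card l (P ∘ inj₁) + card r (P ∘ inj₂) → ∃[ x ] P x ≡ true
  split pos′ with card l (P ∘ inj₁) in cardˡ
  ... | suc _ with a , Pa ← card>0⇒∃ l (P ∘ inj₁) (subst (0 <_) (sym cardˡ) z<s) = inj₁ a , Pa
  ... | zero  with b , Pb ← card>0⇒∃ r (P ∘ inj₂) pos′ = inj₂ b , Pb

card-mono : (t : Tree) {P Q : Subset t} → P ⊆ Q → card t P ≤ card t Q
card-mono leaf {P} {Q} P⊆Q with P tt in Ptt | Q tt in Qtt
... | false | _     = z≤n
... | true  | true  = ≤-refl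
... | true  | false with () ← trans (sym (P⊆Q tt Ptt)) Qtt
card-mono (node lab l r) {P} {Q} P⊆Q = begin
  card (node lab l r) P                 ≡⟨ card-node lab l r P ⟩
  card l (P ∘ inj₁) + card r (P ∘ inj₂) ≤⟨ +-mono-≤ (card-mono l (P⊆Q ∘ inj₁))
                                                   (card-mono r (P⊆Q ∘ inj₂)) ⟩
  card l (Q ∘ inj₁) + card r (Q ∘ inj₂) ≡⟨ card-node lab l r Q ⟨
  card (node lab l r) Q                 ∎
  where open ≤-Reasoning

card-bijection : (s t : Tree) {P : Subset s} {Q : Subset t}
  (f : Vert s → Vert t) (g : Vert t → Vert s) →
  LeftInverseOn P Q f g → LeftInverseOn Q P g f → card s P ≡ card t Q
card-bijection s t f g P→Q Q→P = sym (go _ refl P→Q Q→P)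
  where
  go : ∀ n {P Q} → card s P ≡ n → LeftInverseOn P Q f g → LeftInverseOn Q P g f → card t Q ≡ n
  go zero {P} {Q} cardP _ Q→P with card t Q in cardQ
  ... | zero  = refl
  ... | suc _ with y , Qy ← card>0⇒∃ t Q (subst (0 <_) (sym cardQ) z<s)
              with () ← trans (sym cardP) (card-remove s P (proj₁ (Q→P y Qy)))
  go (suc n) {P} {Q} cardP P→Q Q→P with x , Px ← card>0⇒∃ s P (subst (0 <_) (sym cardP) z<s) =
    trans (card-remove t Q (proj₁ (P→Q x Px))) (cong suc (go n cardP′ P′→Q′ Q′→P′))
    where
    cardP′ : card s (P ∖ singleton s x) ≡ n
    cardP′ = suc-injective (trans (sym (card-remove s P Px)) cardP)
    P′→Q′ : LeftInverseOn (P ∖ singleton s x) (Q ∖ singleton t (f x)) f g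
    P′→Q′ z z∈ with Pz , z≢x ← ∖-singleton⁻ s {P} z∈ with Qfz , gfz≡z ← P→Q z Pz =
      ∖-singleton⁺ t {Q} Qfz
        (λ fz≡fx → z≢x (trans (sym gfz≡z) (trans (cong g fz≡fx) (proj₂ (P→Q x Px))))) ,
      gfz≡z
    Q′→P′ : LeftInverseOn (Q ∖ singleton t (f x)) (P ∖ singleton s x) g f
    Q′→P′ y y∈ with Qy , y≢fx ← ∖-singleton⁻ t {Q} y∈ with Pgy , fgy≡y ← Q→P y Qy =
      ∖-singleton⁺ s {P} Pgy (λ gy≡x → y≢fx (trans (sym fgy≡y) (cong f gy≡x))) ,
      fgy≡y

HasPerfectMatching-cong : (t : Tree) {W W′ : Subset t} →
  W ≗ W′ → HasPerfectMatching t W → HasPerfectMatching t W′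
HasPerfectMatching-cong t W≗W′ (m , matched) = m , λ x W′x →
  let Wmx , adj , mmx = matched x (trans (W≗W′ x) W′x) in
  trans (sym (W≗W′ (m x))) Wmx , adj , mmx

HasPerfectMatching-node : (lab : Label) {l r : Tree} {W : Subset (node lab l r)} →
  HasPerfectMatching l (W ∘ inj₁) → HasPerfectMatching r (W ∘ inj₂) →
  HasPerfectMatching (node lab l r) W
HasPerfectMatching-node lab (mˡ , matchedˡ) (mʳ , matchedʳ) = ⊎.map mˡ mʳ , λ where
  (inj₁ a) Wa → let Wma , adj , mma = matchedˡ a Wa in Wma , adj , cong inj₁ mma
  (inj₂ b) Wb → let Wmb , adj , mmb = matchedʳ b Wb in Wmb , adj , cong inj₂ mmb

HasPerfectMatching-addEdge : (t : Tree) {W : Subset t} {a b : Vert t} →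
  W a ≡ false → W b ≡ false → Adj t a b ≡ true →
  HasPerfectMatching t W → HasPerfectMatching t (W ∪ singleton t a ∪ singleton t b)
HasPerfectMatching-addEdge t {W} {a} {b} Wa Wb ab (m , matched) = m′ , matched′
  where
  W′ : Subset t
  W′ = W ∪ singleton t a ∪ singleton t b

  m′ : Vert t → Vert t
  m′ x with Vert-≟ t x a | Vert-≟ t x b
  ... | yes _ | _     = b
  ... | no _  | yes _ = a
  ... | no _  | no _  = m x

  m′-a : m′ a ≡ b
  m′-a with Vert-≟ t a a
  ... | yes _  = refl
  ... | no a≢a = contradiction refl a≢a

  m′-b : m′ b ≡ a
  m′-b with Vert-≟ t b a | Vert-≟ t b b
  ... | yes b≡a | _      = b≡a
  ... | no _    | yes _  = refl
  ... | no _    | no b≢b = contradiction refl b≢b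

  m′-W : ∀ {x} → W x ≡ true → m′ x ≡ m x
  m′-W {x} Wx with Vert-≟ t x a | Vert-≟ t x b
  ... | yes refl | _        = contradiction (trans (sym Wx) Wa) λ ()
  ... | no _     | yes refl = contradiction (trans (sym Wx) Wb) λ ()
  ... | no _     | no _     = refl

  W⊆W′ : W ⊆ W′
  W⊆W′ x Wx rewrite Wx = refl

  a∈W′ : W′ a ≡ true
  a∈W′ rewrite dec-true (Vert-≟ t a a) refl | ∨-zeroʳ (W a) = refl

  b∈W′ : W′ b ≡ true
  b∈W′ rewrite dec-true (Vert-≟ t b b) refl = ∨-zeroʳ _

  matched′ : ∀ x → W′ x ≡ true →
    W′ (m′ x) ≡ true × Adj t x (m′ x) ≡ true × m′ (m′ x) ≡ x
  matched′ x W′x with Vert-≟ t x a | Vert-≟ t x b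
  ... | yes refl | _        = b∈W′ , ab , m′-b
  ... | no _     | yes refl = a∈W′ , trans (Adj-sym t b a) ab , m′-a
  ... | no _     | no _     =
    let Wx = trans (sym (trans (∨-identityʳ _) (∨-identityʳ (W x)))) W′x
        Wmx , adj , mmx = matched x Wx
    in W⊆W′ (m x) Wmx , adj , trans (m′-W Wmx) mmx

module CrossingEdges {lab : Label} {l r : Tree} {W : Subset (node lab l r)}
  (M : HasPerfectMatching (node lab l r) W) where

  mate : Vert (node lab l r) → Vert (node lab l r)
  mate = proj₁ M

  matched : ∀ x → W x ≡ true →
    W (mate x) ≡ true × Adj (node lab l r) x (mate x) ≡ true × mate (mate x) ≡ x
  matched = proj₂ M

  crossˡ uncrossedˡ : Subset l
  crossˡ     a = not (isLeft (mate (inj₁ a))) ∧ W (inj₁ a)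
  uncrossedˡ a = isLeft (mate (inj₁ a)) ∧ W (inj₁ a)

  crossʳ uncrossedʳ : Subset r
  crossʳ     b = isLeft (mate (inj₂ b)) ∧ W (inj₂ b)
  uncrossedʳ b = not (isLeft (mate (inj₂ b))) ∧ W (inj₂ b)

  crossˡ⊆W : crossˡ ⊆ W ∘ inj₁
  crossˡ⊆W a = proj₂ ∘ ∧-true⁻ {not (isLeft (mate (inj₁ a)))}

  crossʳ⊆W : crossʳ ⊆ W ∘ inj₂
  crossʳ⊆W b = proj₂ ∘ ∧-true⁻ {isLeft (mate (inj₂ b))}

  crossˡ-mate : ∀ a → crossˡ a ≡ true →
    ∃[ b ] (mate (inj₁ a) ≡ inj₂ b × mate (inj₂ b) ≡ inj₁ a ×
            crossʳ b ≡ true × Adj (node lab l r) (inj₁ a) (inj₂ b) ≡ true)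
  crossˡ-mate a a∈ with mate (inj₁ a) in eq | matched (inj₁ a) (crossˡ⊆W a a∈)
  ... | inj₁ _ | _ with () ← trans (sym (cong (not ∘ isLeft) eq)) (proj₁ (∧-true⁻ a∈))
  ... | inj₂ b | Wb , adj , mmb = b , refl , mmb , cong₂ _∧_ (cong isLeft mmb) Wb , adj

  crossʳ-mate : ∀ b → crossʳ b ≡ true →
    ∃[ a ] (mate (inj₂ b) ≡ inj₁ a × mate (inj₁ a) ≡ inj₂ b ×
            crossˡ a ≡ true × Adj (node lab l r) (inj₁ a) (inj₂ b) ≡ true)
  crossʳ-mate b b∈ with mate (inj₂ b) in eq | matched (inj₂ b) (crossʳ⊆W b b∈)
  ... | inj₁ a | Wa , adj , mma = a , refl , mma , cong₂ _∧_ (cong (not ∘ isLeft) mma) Wa , adj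
  ... | inj₂ _ | _ with () ← trans (sym (cong isLeft eq)) (proj₁ (∧-true⁻ b∈))

  crossˡ⊆TS : crossˡ ⊆ TS l
  crossˡ⊆TS a a∈ with _ , _ , _ , _ , adj ← crossˡ-mate a a∈ = proj₁ (Adj-cross⁻ lab {l} {r} adj)

  crossʳ⊆TS : crossʳ ⊆ TS r
  crossʳ⊆TS b b∈ with _ , _ , _ , _ , adj ← crossʳ-mate b b∈ = proj₂ (Adj-cross⁻ lab {l} {r} adj)

  card-crossˡ≡card-crossʳ : card l crossˡ ≡ card r crossʳ
  card-crossˡ≡card-crossʳ = begin
    card l crossˡ                      ≡⟨ card-left lab l r [ crossˡ , ∅ ] (λ _ → refl) ⟨
    card (node lab l r) [ crossˡ , ∅ ] ≡⟨ card-bijection (node lab l r) (node lab l r)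
                                            mate mate left→right right→left ⟩
    card (node lab l r) [ ∅ , crossʳ ] ≡⟨ card-right lab l r [ ∅ , crossʳ ] (λ _ → refl) ⟩
    card r crossʳ                      ∎
    where
    open ≡-Reasoning
    left→right : LeftInverseOn [ crossˡ , ∅ ] [ ∅ , crossʳ ] mate mate
    left→right (inj₁ a) a∈ with b , eq , mmb , b∈ , _ ← crossˡ-mate a a∈ rewrite eq = b∈ , mmb
    right→left : LeftInverseOn [ ∅ , crossʳ ] [ crossˡ , ∅ ] mate mate
    right→left (inj₂ b) b∈ with a , eq , mma , a∈ , _ ← crossʳ-mate b b∈ rewrite eq = a∈ , mma

  matchingˡ : HasPerfectMatching l uncrossedˡ
  matchingˡ = mateˡ , matchedˡ
    where
    mateˡ : Vert l → Vert l
    mateˡ a = [ id , const a ] (mate (inj₁ a))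
    matchedˡ : ∀ a → uncrossedˡ a ≡ true →
      uncrossedˡ (mateˡ a) ≡ true × Adj l a (mateˡ a) ≡ true × mateˡ (mateˡ a) ≡ a
    matchedˡ a a∈ with mate (inj₁ a) in eq | matched (inj₁ a) (proj₂ (∧-true⁻ a∈))
    ... | inj₂ _ | _ with () ← trans (sym (cong isLeft eq)) (proj₁ (∧-true⁻ a∈))
    ... | inj₁ c | Wc , adj , mmc =
      cong₂ _∧_ (cong isLeft mmc) Wc , adj , cong [ id , const c ] mmc

  matchingʳ : HasPerfectMatching r uncrossedʳ
  matchingʳ = mateʳ , matchedʳ
    where
    mateʳ : Vert r → Vert r
    mateʳ b = [ const b , id ] (mate (inj₂ b))
    matchedʳ : ∀ b → uncrossedʳ b ≡ true →
      uncrossedʳ (mateʳ b) ≡ true × Adj r b (mateʳ b) ≡ true × mateʳ (mateʳ b) ≡ b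
    matchedʳ b b∈ with mate (inj₂ b) in eq | matched (inj₂ b) (proj₂ (∧-true⁻ b∈))
    ... | inj₁ _ | _ with () ← trans (sym (cong (not ∘ isLeft) eq)) (proj₁ (∧-true⁻ b∈))
    ... | inj₂ c | Wc , adj , mmc =
      cong₂ _∧_ (cong (not ∘ isLeft) mmc) Wc , adj , cong [ const c , id ] mmc

DominatesNonTwins-attachˡ : {l r : Tree} {S : Subset (node attach l r)} →
  DominatesNonTwins (node attach l r) S → DominatesNonTwins l (S ∘ inj₁)
DominatesNonTwins-attachˡ {l} {r} dom a a∉TS with dom (inj₁ a) a∉TS
... | inj₁ c , Sc , by = c , Sc , map₁ inj₁-injective by
... | inj₂ _ , _ , inj₂ adj with () ← trans (sym a∉TS) (proj₁ (Adj-cross⁻ attach {l} {r} adj))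

DominatesNonTwins-attachʳ : {l r : Tree} {S : Subset (node attach l r)} →
  DominatesNonTwins (node attach l r) S → DominatesNonTwins r (S ∘ inj₂)
DominatesNonTwins-attachʳ {l} {r} dom b b∉TS with dom (inj₂ b) refl
... | inj₂ c , Sc , by = c , Sc , map₁ inj₂-injective by
... | inj₁ _ , _ , inj₂ adj with () ← trans (sym b∉TS) (proj₂ (Adj-cross⁻ attach {l} {r} adj))

DominatesNonTwins-attach : {l r : Tree} {Sˡ : Subset l} {Sʳ : Subset r} →
  DominatesNonTwins l Sˡ → DominatesNonTwins r Sʳ → ∃[ a ] (Sˡ a ≡ true × TS l a ≡ true) →
  DominatesNonTwins (node attach l r) [ Sˡ , Sʳ ]
DominatesNonTwins-attach domˡ _ _ (inj₁ a) a∉TS with c , Sc , by ← domˡ a a∉TS =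
  inj₁ c , Sc , map₁ (cong inj₁) by
DominatesNonTwins-attach {r = r} _ domʳ (a , Sa , a∈TS) (inj₂ b) _ with TS r b in b∈TS
... | true  = inj₁ a , Sa , inj₂ (cong₂ _∧_ a∈TS b∈TS)
... | false with c , Sc , by ← domʳ b b∈TS = inj₂ c , Sc , map₁ (cong inj₂) by

module SplitAtAttach {l r : Tree} {k : ℕ} (S : Subset (node attach l r)) (X : Subset (node attach l r))
  (dom : DominatesNonTwins (node attach l r) S) (X⊆ : X ⊆ S ∩TS (node attach l r))
  (cardX : card (node attach l r) X ≡ k) (M : HasPerfectMatching (node attach l r) (S ∖ X)) where

  open CrossingEdges M

  X-right : X ∘ inj₂ ≗ ∅
  X-right b with X (inj₂ b) in Xb
  ... | false = refl
  ... | true with () ← proj₂ (X⊆ (inj₂ b) Xb)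

  Xˡ⊆ : (X ∘ inj₁ ∪ crossˡ) ⊆ S ∘ inj₁ ∩TS l
  Xˡ⊆ a a∈ with ∨-true⁻ {X (inj₁ a)} a∈
  ... | inj₁ Xa       = X⊆ (inj₁ a) Xa
  ... | inj₂ crossing = proj₁ (∧-true⁻ (crossˡ⊆W a crossing)) , crossˡ⊆TS a crossing

  Xʳ⊆ : crossʳ ⊆ S ∘ inj₂ ∩TS r
  Xʳ⊆ b b∈ = proj₁ (∧-true⁻ (crossʳ⊆W b b∈)) , crossʳ⊆TS b b∈

  X∩crossˡ≡∅ : ∀ a → X (inj₁ a) ∧ crossˡ a ≡ false
  X∩crossˡ≡∅ a with X (inj₁ a)
  ... | true  = trans (cong (not (isLeft (mate (inj₁ a))) ∧_) (∧-zeroʳ (S (inj₁ a)))) (∧-zeroʳ _)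
  ... | false = refl

  cardXˡ : card l (X ∘ inj₁ ∪ crossˡ) ≡ k + card r crossʳ
  cardXˡ = begin
    card l (X ∘ inj₁ ∪ crossˡ)        ≡⟨ card-∪ l _ _ X∩crossˡ≡∅ ⟩
    card l (X ∘ inj₁) + card l crossˡ ≡⟨ cong₂ _+_ (trans (sym (card-left attach l r X X-right)) cardX)
                                                   card-crossˡ≡card-crossʳ ⟩
    k + card r crossʳ                 ∎
    where open ≡-Reasoning

  uncrossedˡ≗ : uncrossedˡ ≗ (S ∘ inj₁) ∖ (X ∘ inj₁ ∪ crossˡ)
  uncrossedˡ≗ a with isLeft (mate (inj₁ a)) | S (inj₁ a) | X (inj₁ a)
  ... | true  | true  | true  = refl
  ... | true  | true  | false = refl
  ... | true  | false | _     = refl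
  ... | false | true  | true  = refl
  ... | false | true  | false = refl
  ... | false | false | _     = refl

  uncrossedʳ≗ : uncrossedʳ ≗ (S ∘ inj₂) ∖ crossʳ
  uncrossedʳ≗ b rewrite X-right b with isLeft (mate (inj₂ b)) | S (inj₂ b)
  ... | true  | true  = refl
  ... | true  | false = refl
  ... | false | true  = refl
  ... | false | false = refl

  feasibleˡ : Feasible l (k + card r crossʳ) (card l (S ∘ inj₁))
  feasibleˡ = S ∘ inj₁ , refl , DominatesNonTwins-attachˡ dom , X ∘ inj₁ ∪ crossˡ , Xˡ⊆ , cardXˡ ,
              HasPerfectMatching-cong l uncrossedˡ≗ matchingˡ

  feasibleʳ : Feasible r (card r crossʳ) (card r (S ∘ inj₂))
  feasibleʳ = S ∘ inj₂ , refl , DominatesNonTwins-attachʳ dom , crossʳ , Xʳ⊆ , refl ,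
              HasPerfectMatching-cong r uncrossedʳ≗ matchingʳ

Feasible-attach⁻ : {l r : Tree} {k s : ℕ} → Feasible (node attach l r) k s →
  ∃[ j ] ∃[ sˡ ] ∃[ sʳ ] (Feasible l (k + j) sˡ × Feasible r j sʳ × sˡ + sʳ ≡ s)
Feasible-attach⁻ {l} {r} (S , cardS , dom , X , X⊆ , cardX , M) =
  _ , _ , _ , feasibleˡ , feasibleʳ , trans (sym (card-node attach l r S)) cardS
  where open SplitAtAttach S X dom X⊆ cardX M

HasPerfectMatching-unmarkPair : {l r : Tree} (S : Subset (node attach l r))
  {A : Subset l} {B : Subset r} {a : Vert l} {b : Vert r} →
  A ⊆ S ∘ inj₁ ∩TS l → B ⊆ S ∘ inj₂ ∩TS r → A a ≡ true → B b ≡ true →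
  HasPerfectMatching (node attach l r) (S ∖ [ A , B ]) →
  HasPerfectMatching (node attach l r) (S ∖ [ A ∖ singleton l a , B ∖ singleton r b ])
HasPerfectMatching-unmarkPair {l} {r} S {A} {B} {a} {b} A⊆ B⊆ Aa Bb M =
  HasPerfectMatching-cong v unmark (HasPerfectMatching-addEdge v a∉ b∉ adj M)
  where
  v : Tree
  v = node attach l r
  a∉ : (S ∖ [ A , B ]) (inj₁ a) ≡ false
  a∉ rewrite Aa = ∧-zeroʳ (S (inj₁ a))
  b∉ : (S ∖ [ A , B ]) (inj₂ b) ≡ false
  b∉ rewrite Bb = ∧-zeroʳ (S (inj₂ b))
  adj : Adj v (inj₁ a) (inj₂ b) ≡ true
  adj = cong₂ _∧_ (proj₂ (A⊆ a Aa)) (proj₂ (B⊆ b Bb))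
  untouched : ∀ s x → (s ∧ not x ∨ false) ∨ false ≡ s ∧ not (x ∧ true)
  untouched s x rewrite ∧-identityʳ x = trans (∨-identityʳ _) (∨-identityʳ _)
  unmark : S ∖ [ A , B ] ∪ singleton v (inj₁ a) ∪ singleton v (inj₂ b) ≗
           S ∖ [ A ∖ singleton l a , B ∖ singleton r b ]
  unmark (inj₁ c) with Vert-≟ l c a
  ... | yes refl rewrite proj₁ (A⊆ a Aa) | Aa = refl
  ... | no _     = untouched (S (inj₁ c)) (A c)
  unmark (inj₂ c) with Vert-≟ r c b
  ... | yes refl rewrite proj₁ (B⊆ b Bb) | Bb = refl
  ... | no _     = untouched (S (inj₂ c)) (B c)

HasPerfectMatching-unmarkRight : {l r : Tree} (j : ℕ) {k : ℕ} (S : Subset (node attach l r))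
  {A : Subset l} {B : Subset r} →
  A ⊆ S ∘ inj₁ ∩TS l → B ⊆ S ∘ inj₂ ∩TS r → card l A ≡ k + j → card r B ≡ j →
  HasPerfectMatching (node attach l r) (S ∖ [ A , B ]) →
  ∃[ A′ ] (A′ ⊆ A × card l A′ ≡ k × HasPerfectMatching (node attach l r) (S ∖ [ A′ , ∅ ]))
HasPerfectMatching-unmarkRight {l} {r} zero {k} S {A} {B} _ _ cardA cardB M =
  A , (λ _ → id) , trans cardA (+-identityʳ k) , HasPerfectMatching-cong (node attach l r) B≗∅ M
  where
  B≗∅ : S ∖ [ A , B ] ≗ S ∖ [ A , ∅ ]
  B≗∅ (inj₁ _) = refl
  B≗∅ (inj₂ b) = cong (λ x → S (inj₂ b) ∧ not x) (card≡0⇒∅ r B cardB b)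
HasPerfectMatching-unmarkRight {l} {r} (suc j) {k} S {A} {B} A⊆ B⊆ cardA cardB M
  with a , Aa ← card>0⇒∃ l A (subst (0 <_) (sym (trans cardA (+-suc k j))) z<s)
     | b , Bb ← card>0⇒∃ r B (subst (0 <_) (sym cardB) z<s)
  with A′ , A′⊆ , cardA′ , M′ ←
         HasPerfectMatching-unmarkRight j S {A ∖ singleton l a} {B ∖ singleton r b}
           (λ x → A⊆ x ∘ ∖-⊆ A (singleton l a) x) (λ x → B⊆ x ∘ ∖-⊆ B (singleton r b) x)
           (suc-injective (trans (sym (card-remove l A Aa)) (trans cardA (+-suc k j))))
           (suc-injective (trans (sym (card-remove r B Bb)) cardB))
           (HasPerfectMatching-unmarkPair S A⊆ B⊆ Aa Bb M)
  = A′ , (λ x → ∖-⊆ A (singleton l a) x ∘ A′⊆ x) , cardA′ , M′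

Feasible-attach⁺ : {l r : Tree} {k j sˡ sʳ : ℕ} →
  Feasible l (k + j) sˡ → Feasible r j sʳ → 0 < k + j → Feasible (node attach l r) k (sˡ + sʳ)
Feasible-attach⁺ {l} {r} {k} {j} (Sˡ , cardSˡ , domˡ , Xˡ , Xˡ⊆ , cardXˡ , Mˡ)
                                 (Sʳ , cardSʳ , domʳ , Xʳ , Xʳ⊆ , cardXʳ , Mʳ) k+j>0
  with A , A⊆Xˡ , cardA , M ← HasPerfectMatching-unmarkRight j [ Sˡ , Sʳ ] Xˡ⊆ Xʳ⊆ cardXˡ cardXʳ
                                 (HasPerfectMatching-node attach Mˡ Mʳ)
  with a , Xˡa ← card>0⇒∃ l Xˡ (subst (0 <_) (sym cardXˡ) k+j>0) =
  [ Sˡ , Sʳ ] , trans (card-node attach l r _) (cong₂ _+_ cardSˡ cardSʳ) ,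
  DominatesNonTwins-attach domˡ domʳ (a , Xˡ⊆ a Xˡa) ,
  [ A , ∅ ] , (λ where (inj₁ a) → Xˡ⊆ a ∘ A⊆Xˡ a ; (inj₂ _) ()) ,
  trans (card-left attach l r [ A , ∅ ] (λ _ → refl)) cardA ,
  M

o+p≡m+n⇒o≡m×p≡n : ∀ {m n o p} → m ≤ o → n ≤ p → o + p ≡ m + n → o ≡ m × p ≡ n
o+p≡m+n⇒o≡m×p≡n {m} {n} {o} {p} m≤o n≤p o+p≡m+n =
  o≡m , +-cancelˡ-≡ m p n (trans (cong (_+ p) (sym o≡m)) o+p≡m+n)
  where
  o≡m : o ≡ m
  o≡m = ≤-antisym (+-cancelʳ-≤ p o m (subst (_≤ m + p) (sym o+p≡m+n) (+-monoʳ-≤ m n≤p))) m≤o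

Feasible⇒≤tsSize : (t : Tree) {k s : ℕ} → Feasible t k s → k ≤ tsSize t
Feasible⇒≤tsSize t (_ , _ , _ , _ , X⊆ , refl , _) = card-mono t (λ x → proj₂ ∘ X⊆ x)

IsMin⇒≤ : {t : Tree} {m k s : ℕ} → IsMin t m → Feasible t k s → m ≤ s
IsMin⇒≤ {t} (_ , lower) F = lower _ (Feasible⇒≤tsSize t F) _ F

IsMin⇒IsGamma : {t : Tree} {m k : ℕ} → IsMin t m → Feasible t k m → IsGamma t k m
IsMin⇒IsGamma min F = F , λ _ → IsMin⇒≤ min

module _ {l r : Tree} {mˡ mʳ : ℕ} (minˡ : IsMin l mˡ) (minʳ : IsMin r mʳ) where

  attach-≤ : {k s : ℕ} → Feasible (node attach l r) k s → mˡ + mʳ ≤ s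
  attach-≤ F with _ , _ , _ , Fˡ , Fʳ , refl ← Feasible-attach⁻ F =
    +-mono-≤ (IsMin⇒≤ minˡ Fˡ) (IsMin⇒≤ minʳ Fʳ)

  attach-optimal⁻ : {k : ℕ} → Feasible (node attach l r) k (mˡ + mʳ) →
    ∃[ j ] (IsGamma l (k + j) mˡ × IsGamma r j mʳ)
  attach-optimal⁻ F with j , _ , _ , Fˡ , Fʳ , sˡ+sʳ≡ ← Feasible-attach⁻ F
    with refl , refl ← o+p≡m+n⇒o≡m×p≡n (IsMin⇒≤ minˡ Fˡ) (IsMin⇒≤ minʳ Fʳ) sˡ+sʳ≡ =
    j , IsMin⇒IsGamma minˡ Fˡ , IsMin⇒IsGamma minʳ Fʳ

lemma32 : (vl vr : Tree) → Staircase vl → Staircase vr →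
    (al bl ar br : ℕ) → IsAlpha vl al → IsBeta vl bl → IsAlpha vr ar → IsBeta vr br →
    ar ≤ bl → ¬ (al ≡ 0 × br ≡ 0) → ¬ (ar ≡ 0 × bl ≡ 0) →
    IsBeta (node attach vl vr) (bl ∸ ar)
lemma32 vl vr _ _ _ bl ar _ _ (mˡ , minˡ , _ , (Fˡ , _) , bl-largest)
        (mʳ , minʳ , _ , (Fʳ , _) , ar-smallest) _ ar≤bl _ ¬ar≡0×bl≡0 =
  mˡ + mʳ , min , Feasible⇒≤tsSize v F , IsMin⇒IsGamma min F , largest
  where
  v : Tree
  v = node attach vl vr
  bl∸ar+ar≡bl : bl ∸ ar + ar ≡ bl
  bl∸ar+ar≡bl = m∸n+n≡m ar≤bl
  bl>0 : 0 < bl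
  bl>0 = n≢0⇒n>0 (λ bl≡0 → ¬ar≡0×bl≡0 (n≤0⇒n≡0 (subst (ar ≤_) bl≡0 ar≤bl) , bl≡0))
  F : Feasible v (bl ∸ ar) (mˡ + mʳ)
  F = Feasible-attach⁺ (subst (λ k → Feasible vl k mˡ) (sym bl∸ar+ar≡bl) Fˡ) Fʳ
                       (subst (0 <_) (sym bl∸ar+ar≡bl) bl>0)
  min : IsMin v (mˡ + mʳ)
  min = (bl ∸ ar , Feasible⇒≤tsSize v F , F , λ _ → attach-≤ minˡ minʳ) ,
        λ _ _ _ → attach-≤ minˡ minʳ
  largest : ∀ k → k ≤ tsSize v → IsGamma v k (mˡ + mʳ) → k ≤ bl ∸ ar
  largest k _ (Fk , _) with j , γˡ , γʳ ← attach-optimal⁻ minˡ minʳ Fk =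
    m+n≤o⇒m≤o∸n k (≤-trans (+-monoʳ-≤ k ar≤j) k+j≤bl)
    where
    ar≤j : ar ≤ j
    ar≤j = ar-smallest j (Feasible⇒≤tsSize vr (proj₁ γʳ)) γʳ
    k+j≤bl : k + j ≤ bl
    k+j≤bl = bl-largest (k + j) (Feasible⇒≤tsSize vl (proj₁ γˡ)) γˡ
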